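{- Let $T'$ be a finite tree with $2n$ leaves, and let $\mathcal{L}$ denote its set of leaves. Then there exist a vertex $v\in V(T')$ and a bijection $\alpha:\mathcal{L}\rightarrow\mathcal{L}$ such that the path system $\{P_{\ell,\alpha(\ell)} : \ell\in\mathcal{L}\}$ covers every vertex of $T'$ and every path $P_{\ell,\alpha(\ell)}$ contains $v$.
   Context: For vertices $u,v$ of a tree, $P_{u,v}$ denotes the unique path in the tree between $u$ and $v$. -}

module Defs where

open import Data.Nat using (ℕ; suc; _≤_)
open import Data.Bool using (Bool; true; false; T)
open import Data.Fin using (Fin)
open import Data.List using (List; []; _∷_; length; filter; allFin)
open import Data.Nat using (_≟_)
open import Data.List.Membership.Propositional using (_∈_)
open import Data.List.Relation.Unary.Unique.Propositional using (Unique)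
open import Data.Product using (Σ; _×_; ∃)
open import Data.Empty using (⊥)
open import Relation.Binary.PropositionalEquality using (_≡_)
open import Relation.Nullary using (¬_)
open import Data.Bool.Properties using (T?)

record Graph (m : ℕ) : Set where
  field
    adj     : Fin m → Fin m → Bool
    sym     : ∀ u v → adj u v ≡ adj v u
    irrefl  : ∀ u → adj u u ≡ false
open Graph public

module _ {m : ℕ} (G : Graph m) where

  data Walk : Fin m → Fin m → List (Fin m) → Set where
    here : ∀ {u} → Walk u u (u ∷ [])
    step : ∀ {u w v xs} → T (adj G u w) → Walk w v xs → Walk u v (u ∷ xs)

  IsPath : Fin m → Fin m → List (Fin m) → Set
  IsPath u v xs = Walk u v xs × Unique xs

  IsCycle : List (Fin m) → Set
  IsCycle xs = Σ (Fin m) λ u → Σ (Fin m) λ v →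
    IsPath u v xs × 3 ≤ length xs × T (adj G v u)

  Connected : Set
  Connected = ∀ u v → ∃ λ xs → Walk u v xs

  Acyclic : Set
  Acyclic = ∀ xs → ¬ IsCycle xs

  IsTree : Set
  IsTree = Connected × Acyclic

  degree : Fin m → ℕ
  degree v = length (filter (λ u → T? (adj G v u)) (allFin m))

  IsLeaf : Fin m → Set
  IsLeaf v = degree v ≡ 1

  Leaf : Set
  Leaf = Σ (Fin m) IsLeaf

  leaves : List (Fin m)
  leaves = filter (λ v → degree v ≟ 1) (allFin m)

  -- w lies on P_{u,v}: in a tree the path between u and v is unique,
  -- so this is membership in that unique path.
  OnPath : Fin m → Fin m → Fin m → Set
  OnPath u v w = Σ (List (Fin m)) λ xs → IsPath u v xs × w ∈ xs

module Submission where

-- Take for v a leaf centroid r: a vertex at which every branch (the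
-- vertices reached from r through one fixed neighbour) contains at most n
-- leaves.  It exists since stepping from r into a branch with more than n
-- leaves makes every heavy branch strictly smaller.  Sort the 2n leaves by
-- branch and pair the j-th with the (n+j)-th: as no branch holds more than n
-- leaves, partners lie in different branches, so the path between them is
-- the union of their paths to r.  Every vertex w ≠ r lies on the path from r
-- to some leaf, hence on one of the chosen paths.

open import Defs hiding (sym)
open import Data.Nat using (ℕ; zero; suc; _+_; _*_; _≤_; _<_; _<?_; z≤n; s≤s; s≤s⁻¹)
  renaming (_≟_ to _≟ⁿ_)
open import Data.Nat.Properties
  using (≤-trans; <-≤-trans; ≤-reflexive; ≤-antisym; ≮⇒≥; <⇒≱; n≮0; n<1+n; m≤m+n; m≤n+m;
         +-identityʳ; +-assoc; +-comm; +-monoʳ-≤; +-mono-<; +-mono-<-≤; +-cancelˡ-≡; ≤-decTotalOrder)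
  renaming (≡-irrelevant to ℕ-≡-irrelevant)
open import Data.Fin as Fin using (Fin; toℕ; fromℕ<; cast; _↑ˡ_; _↑ʳ_; splitAt)
  renaming (_≟_ to _≟ᶠ_)
open import Data.Fin.Properties
  using (pigeonhole; <⇒≢; any?; toℕ-injective; toℕ-fromℕ<; toℕ-cast; toℕ<n; toℕ-↑ˡ; toℕ-↑ʳ;
         cast-involutive; splitAt-join; join-splitAt; splitAt⁻¹-↑ˡ; splitAt⁻¹-↑ʳ)
open import Data.Bool using (T)
open import Data.Bool.Properties using (T?)
open import Data.List using (List; []; _∷_; _++_; [_]; length; reverse; drop; filter; lookup; tabulate; allFin)
open import Data.List.Properties
  using (length-++; length-filter; length-tabulate; ++-assoc; ++-identityʳ; ++-identityʳ-unique;
         ++-conicalˡ; ∷ʳ-injective; unfold-reverse)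
open import Data.List.Membership.Propositional using (_∈_; _∉_)
open import Data.List.Membership.Propositional.Properties
  using (∈-∃++; ∈-++⁺ˡ; ∈-++⁺ʳ; ∈-++⁻; ∈-allFin; ∈-filter⁺; ∈-filter⁻; ∈-lookup;
         ∈-tabulate⁻)
open import Data.List.Relation.Unary.Any using (here; there; index)
import Data.List.Relation.Unary.Any.Properties as Any
open import Data.List.Relation.Unary.All as All using (All; []; _∷_)
import Data.List.Relation.Unary.All.Properties as All
open import Data.List.Relation.Unary.Unique.Propositional using (Unique; []; _∷_)
import Data.List.Relation.Unary.Unique.Propositional.Properties as Unique
open import Data.List.Relation.Binary.Disjoint.Propositional using (Disjoint)
open import Data.List.Relation.Binary.Permutation.Propositional using (↭-sym; ↭⇒↭ₛ)
open import Data.List.Relation.Binary.Permutation.Propositional.Properties using (↭-reverse; ∈-resp-↭; ↭-length)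
import Data.List.Relation.Binary.Permutation.Setoid.Properties as Permutation
open import Data.List.Relation.Unary.Sorted.TotalOrder.Properties using (lookup-mono-≤)
import Data.List.Sort as Sort
import Relation.Binary.Construct.On as On
open import Relation.Binary.Bundles using (DecTotalOrder)
open import Data.Product using (Σ; ∃; _×_; _,_; proj₁; proj₂)
open import Data.Sum using (inj₁; inj₂; swap)
open import Data.Sum.Properties using (swap-involutive)
open import Data.Empty using (⊥; ⊥-elim)
open import Level using (0ℓ)
open import Function using (_∘_)
open import Function.Bundles using (_⤖_; Bijection; mk↔ₛ′)
open import Function.Properties.Inverse using (↔⇒⤖)
open import Relation.Nullary using (¬_; yes; no)
open import Relation.Nullary.Decidable using (_×-dec_; ¬?; decidable-stable)
open import Relation.Unary using (Pred; Decidable)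
open import Relation.Binary.PropositionalEquality hiding ([_])

module _ {A : Set} where

  lookup-injective : ∀ {xs : List A} → Unique xs → ∀ {i j} → lookup xs i ≡ lookup xs j → i ≡ j
  lookup-injective {x ∷ xs} (x∉ ∷ u) {Fin.zero}  {Fin.zero}  eq = refl
  lookup-injective {x ∷ xs} (x∉ ∷ u) {Fin.zero}  {Fin.suc j} eq = ⊥-elim (All.lookup x∉ (∈-lookup j) eq)
  lookup-injective {x ∷ xs} (x∉ ∷ u) {Fin.suc i} {Fin.zero}  eq = ⊥-elim (All.lookup x∉ (∈-lookup i) (sym eq))
  lookup-injective {x ∷ xs} (x∉ ∷ u) {Fin.suc i} {Fin.suc j} eq = cong Fin.suc (lookup-injective u eq)

  unique-length-≤ : ∀ {xs ys : List A} → Unique xs → (∀ {x} → x ∈ xs → x ∈ ys) → length xs ≤ length ys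
  unique-length-≤ {xs} {ys} u sub = ≮⇒≥ λ ys<xs →
    let (i , j , i<j , same) = pigeonhole ys<xs position in
    <⇒≢ i<j (lookup-injective u (trans (located i) (trans (cong (lookup ys) same) (sym (located j)))))
    where
    position : Fin (length xs) → Fin (length ys)
    position i = index (sub (∈-lookup i))
    located : ∀ i → lookup xs i ≡ lookup ys (position i)
    located i = Any.lookup-index (sub (∈-lookup i))

  element : ∀ {xs : List A} → 0 < length xs → ∃ (_∈ xs)
  element {x ∷ _} _ = x , here refl

  unique-head : ∀ {x : A} {xs} → Unique (x ∷ xs) → x ∉ xs
  unique-head (x∉ ∷ _) x∈ = All.lookup x∉ x∈ refl

  unique-++ˡ : ∀ (xs : List A) {ys} → Unique (xs ++ ys) → Unique xs
  unique-++ˡ []       _        = []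
  unique-++ˡ (x ∷ xs) (x∉ ∷ u) = All.++⁻ˡ xs x∉ ∷ unique-++ˡ xs u

  unique-++ʳ : ∀ (xs : List A) {ys} → Unique (xs ++ ys) → Unique ys
  unique-++ʳ []       u       = u
  unique-++ʳ (x ∷ xs) (_ ∷ u) = unique-++ʳ xs u

  unique-reverse : ∀ {xs : List A} → Unique xs → Unique (reverse xs)
  unique-reverse {xs} = Permutation.Unique-resp-↭ (setoid A) (↭⇒↭ₛ (↭-sym (↭-reverse xs)))

  ∈-tail : ∀ {x : A} xs → x ∈ drop 1 xs → x ∈ xs
  ∈-tail (_ ∷ _) x∈ = there x∈

  second : A → List A → A
  second d (_ ∷ y ∷ _) = y
  second d _           = d

  second-++ : ∀ (d : A) xs ys → 2 ≤ length xs → second d (xs ++ ys) ≡ second d xs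
  second-++ d (x ∷ y ∷ xs) ys _       = refl
  second-++ d (x ∷ [])     ys (s≤s ())

module Counting {m : ℕ} where

  count : {P : Pred (Fin m) 0ℓ} → Decidable P → ℕ
  count P? = length (filter P? (allFin m))

  module _ {P : Pred (Fin m) 0ℓ} (P? : Decidable P) where

    counted-unique : Unique (filter P? (allFin m))
    counted-unique = Unique.filter⁺ P? {xs = allFin m} (Unique.allFin⁺ m)

    counted-sound : ∀ {x} → x ∈ filter P? (allFin m) → P x
    counted-sound x∈ = proj₂ (∈-filter⁻ P? {xs = allFin m} x∈)

    count-≥ : ∀ {xs} → Unique xs → (∀ {x} → x ∈ xs → P x) → length xs ≤ count P?
    count-≥ u all = unique-length-≤ u (λ x∈ → ∈-filter⁺ P? (∈-allFin _) (all x∈))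

    count-≤1 : ∀ p → (∀ {x} → P x → x ≡ p) → count P? ≤ 1
    count-≤1 p only = unique-length-≤ {ys = [ p ]} counted-unique (λ x∈ → here (only (counted-sound x∈)))

    count-≤-size : count P? ≤ m
    count-≤-size = ≤-trans (length-filter P? (allFin m)) (≤-reflexive (length-tabulate _))

    count-witness : 0 < count P? → ∃ P
    count-witness pos = let x , x∈ = element pos in x , counted-sound x∈

  count-disjoint : ∀ {P Q R : Pred (Fin m) 0ℓ} (P? : Decidable P) (Q? : Decidable Q) (R? : Decidable R) →
                   (∀ {x} → P x → Q x → ⊥) → (∀ {x} → P x → R x) → (∀ {x} → Q x → R x) →
                   count P? + count Q? ≤ count R?
  count-disjoint {R = R} P? Q? R? disjoint P⊆R Q⊆R =
    subst (_≤ count R?) (length-++ (filter P? (allFin m)))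
      (count-≥ R? (Unique.++⁺ (counted-unique P?) (counted-unique Q?)
                     (λ (x∈P , x∈Q) → disjoint (counted-sound P? x∈P) (counted-sound Q? x∈Q)))
                  in-R)
    where
    in-R : ∀ {x} → x ∈ filter P? (allFin m) ++ filter Q? (allFin m) → R x
    in-R x∈ with ∈-++⁻ (filter P? (allFin m)) x∈
    ... | inj₁ x∈P = P⊆R (counted-sound P? x∈P)
    ... | inj₂ x∈Q = Q⊆R (counted-sound Q? x∈Q)

module Graphs {m : ℕ} (G : Graph m) where

  Adj : Fin m → Fin m → Set
  Adj u v = T (adj G u v)

  adj? : ∀ u → Decidable (Adj u)
  adj? u v = T? (adj G u v)

  adj-sym : ∀ {u v} → Adj u v → Adj v u
  adj-sym {u} {v} = subst T (Graph.sym G u v)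

  adj-irrefl : ∀ {u v} → Adj u v → u ≢ v
  adj-irrefl {u} u~u refl = subst T (irrefl G u) u~u

  -- Being a leaf is decided exactly as in the definition of leaves G, so
  -- count isLeaf? is the number of leaves.
  isLeaf? : Decidable (IsLeaf G)
  isLeaf? v = degree G v ≟ⁿ 1

  leaf-∈ : (ℓ : Leaf G) → proj₁ ℓ ∈ leaves G
  leaf-∈ (x , leaf) = ∈-filter⁺ isLeaf? (∈-allFin x) leaf

  Leaf-≡ : ∀ {ℓ ℓ′ : Leaf G} → proj₁ ℓ ≡ proj₁ ℓ′ → ℓ ≡ ℓ′
  Leaf-≡ {x , leaf} {.x , leaf′} refl = cong (x ,_) (ℕ-≡-irrelevant leaf leaf′)

  walk-start : ∀ {a b xs} → Walk G a b xs → ∃ λ ys → xs ≡ a ∷ ys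
  walk-start here       = [] , refl
  walk-start (step _ _) = _ , refl

  walk-end : ∀ {a b xs} → Walk G a b xs → b ∈ xs
  walk-end here       = here refl
  walk-end (step _ w) = there (walk-end w)

  walk-end-unique : ∀ {a a′ b b′ xs} → Walk G a b xs → Walk G a′ b′ xs → b ≡ b′
  walk-end-unique here       here         = refl
  walk-end-unique here       (step _ ())
  walk-end-unique (step _ ()) here
  walk-end-unique (step _ w) (step _ w′)  = walk-end-unique w w′

  walk-length-2 : ∀ {a b xs} → Walk G a b xs → a ≢ b → 2 ≤ length xs
  walk-length-2 here                  a≢b = ⊥-elim (a≢b refl)
  walk-length-2 (step _ here)         _   = s≤s (s≤s z≤n)
  walk-length-2 (step _ (step _ _))   _   = s≤s (s≤s z≤n)

  walk-second : ∀ {a b xs} → Walk G a b xs → a ≢ b → Adj a (second a xs) × second a xs ∈ xs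
  walk-second here                  a≢b = ⊥-elim (a≢b refl)
  walk-second (step a~c here)       _   = a~c , there (here refl)
  walk-second (step a~c (step _ _)) _   = a~c , there (here refl)

  walk-++ : ∀ {a b c xs ys} → Walk G a b xs → Walk G b c ys → Walk G a c (xs ++ drop 1 ys)
  walk-++ here here       = here
  walk-++ here (step e w) = step e w
  walk-++ (step e w) w′   = step e (walk-++ w w′)

  walk-snoc : ∀ {a b c xs} → Walk G a b xs → Adj b c → Walk G a c (xs ++ [ c ])
  walk-snoc w b~c = walk-++ w (step b~c here)

  walk-reverse : ∀ {a b xs} → Walk G a b xs → Walk G b a (reverse xs)
  walk-reverse here = here
  walk-reverse {a} (step {xs = xs} a~c w) =
    subst (Walk G _ a) (sym (unfold-reverse a xs)) (walk-snoc (walk-reverse w) (adj-sym a~c))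

  walk-prefix : ∀ {a b z suf} pre → Walk G a b (pre ++ z ∷ suf) → Walk G a z (pre ++ [ z ])
  walk-prefix []            here       = here
  walk-prefix []            (step _ _) = here
  walk-prefix (_ ∷ [])      (step e w) = step e (walk-prefix [] w)
  walk-prefix (_ ∷ q ∷ pre) (step e w) = step e (walk-prefix (q ∷ pre) w)

  walk-suffix : ∀ {a b z suf} pre → Walk G a b (pre ++ z ∷ suf) → Walk G z b (z ∷ suf)
  walk-suffix []            here       = here
  walk-suffix []            (step e w) = step e w
  walk-suffix (_ ∷ [])      (step _ w) = walk-suffix [] w
  walk-suffix (_ ∷ q ∷ pre) (step _ w) = walk-suffix (q ∷ pre) w

  path-prefix : ∀ {a b z suf} pre → IsPath G a b (pre ++ z ∷ suf) → IsPath G a z (pre ++ [ z ])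
  path-prefix {z = z} {suf} pre (w , u) =
    walk-prefix pre w , unique-++ˡ (pre ++ [ z ]) (subst Unique (sym (++-assoc pre [ z ] suf)) u)

  path-suffix : ∀ {a b z suf} pre → IsPath G a b (pre ++ z ∷ suf) → IsPath G z b (z ∷ suf)
  path-suffix pre (w , u) = walk-suffix pre w , unique-++ʳ pre u

  path-cons : ∀ {a b c xs} → Adj a b → IsPath G b c xs → a ∉ xs → IsPath G a c (a ∷ xs)
  path-cons {xs = xs} a~b (w , u) a∉ = step a~b w , All.¬Any⇒All¬ xs a∉ ∷ u

  path-snoc : ∀ {a b c xs} → IsPath G a b xs → Adj b c → c ∉ xs → IsPath G a c (xs ++ [ c ])
  path-snoc (w , u) b~c c∉ = walk-snoc w b~c , Unique.++⁺ u ([] ∷ []) λ { (c∈ , here refl) → c∉ c∈ }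

  path-reverse : ∀ {a b xs} → IsPath G a b xs → IsPath G b a (reverse xs)
  path-reverse (w , u) = walk-reverse w , unique-reverse u

  path-++ : ∀ {a b c xs ys} → IsPath G a b xs → IsPath G b c ys → Disjoint xs (drop 1 ys) →
            IsPath G a c (xs ++ drop 1 ys)
  path-++ (w , u) (w′ , u′) disjoint = walk-++ w w′ , Unique.++⁺ u (Unique.drop⁺ 1 u′) disjoint

  path-leaves-start : ∀ {a b xs z} → IsPath G a b xs → z ∈ drop 1 xs → z ≢ a
  path-leaves-start (step _ _ , u) z∈ refl = unique-head u z∈

  open import Data.List.Membership.DecPropositional (_≟ᶠ_ {m}) using (_∈?_)

  loop-erasure : ∀ {a b xs} → Walk G a b xs → ∃ λ ys → IsPath G a b ys × (∀ {z} → z ∈ ys → z ∈ xs)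
  loop-erasure here = _ , (here , [] ∷ []) , λ z∈ → z∈
  loop-erasure (step {u} u~w walk) with loop-erasure walk
  ... | ys , path , ys⊆ with u ∈? ys
  ... | no u∉ = u ∷ ys , path-cons u~w path u∉ , λ { (here eq) → here eq ; (there z∈) → there (ys⊆ z∈) }
  ... | yes u∈ with ∈-∃++ u∈
  ... | pre , suf , refl = u ∷ suf , path-suffix pre path , λ z∈ → there (ys⊆ (∈-++⁺ʳ pre z∈))

  -- In an acyclic graph there is at most one path between two vertices:
  -- two paths leaving a through different neighbours c ≠ d would close,
  -- after loop erasure, the cycle a → c → ⋯ → d → a.
  paths-unique : Acyclic G → ∀ {a b xs ys} → IsPath G a b xs → IsPath G a b ys → xs ≡ ys
  paths-unique ac (here , _) (here , _) = refl
  paths-unique ac (here , _) (step _ w , u) = ⊥-elim (unique-head u (walk-end w))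
  paths-unique ac (step _ w , u) (here , _) = ⊥-elim (unique-head u (walk-end w))
  paths-unique ac {a} (step {w = c} a~c w , u@(_ ∷ u′)) (step {w = d} a~d w′ , v@(_ ∷ v′))
    with c ≟ᶠ d
  ... | yes refl = cong (a ∷_) (paths-unique ac (w , u′) (w′ , v′))
  ... | no c≢d with loop-erasure (walk-++ w (walk-reverse w′))
  ... | zs , (zw , zu) , zs⊆ =
    ⊥-elim (ac (a ∷ zs)
      (a , d , path-cons a~c (zw , zu) a∉zs , s≤s (walk-length-2 zw c≢d) , adj-sym a~d))
    where
    a∉zs : a ∉ zs
    a∉zs a∈ with ∈-++⁻ _ (zs⊆ a∈)
    ... | inj₁ a∈xs = unique-head u a∈xs
    ... | inj₂ a∈ys = unique-head v (Any.reverse⁻ (∈-tail _ a∈ys))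

-- A tree seen from an arbitrary root r.  rpath r x is the path from r to x,
-- and branch r x its second vertex: the neighbour of r through which x is
-- reached (with branch r r = r).

module RootedTree {m : ℕ} (G : Graph m) (tree : IsTree G) where
  open Graphs G
  open Counting
  open import Data.List.Membership.DecPropositional (_≟ᶠ_ {m}) using (_∈?_)

  rpath : Fin m → Fin m → List (Fin m)
  rpath r x = proj₁ (loop-erasure (proj₂ (proj₁ tree r x)))

  rpath-isPath : ∀ r x → IsPath G r x (rpath r x)
  rpath-isPath r x = proj₁ (proj₂ (loop-erasure (proj₂ (proj₁ tree r x))))

  rpath-walk : ∀ r x → Walk G r x (rpath r x)
  rpath-walk r x = proj₁ (rpath-isPath r x)

  rpath-unique : ∀ {r x xs} → IsPath G r x xs → rpath r x ≡ xs
  rpath-unique = paths-unique (proj₂ tree) (rpath-isPath _ _)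

  rpath-start : ∀ r x → r ∈ rpath r x
  rpath-start r x with walk-start (rpath-walk r x)
  ... | _ , eq = subst (r ∈_) (sym eq) (here refl)

  rpath-end : ∀ r x → x ∈ rpath r x
  rpath-end r x = walk-end (rpath-walk r x)

  rpath-length-≤ : ∀ r x → length (rpath r x) ≤ m
  rpath-length-≤ r x = ≤-trans (unique-length-≤ (proj₂ (rpath-isPath r x)) (λ _ → ∈-allFin _))
                                (≤-reflexive (length-tabulate _))

  rpath-injective : ∀ {r x y} → rpath r x ≡ rpath r y → x ≡ y
  rpath-injective {r} {x} {y} eq =
    walk-end-unique (rpath-walk r x) (subst (Walk G r y) (sym eq) (rpath-walk r y))

  rpath-neighbour : ∀ {r c} → Adj r c → rpath r c ≡ r ∷ c ∷ []
  rpath-neighbour r~c = rpath-unique (step r~c here , (adj-irrefl r~c ∷ []) ∷ [] ∷ [])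

  rpath-extend : ∀ {r w c} → Adj w c → c ∉ rpath r w → rpath r c ≡ rpath r w ++ [ c ]
  rpath-extend w~c c∉ = rpath-unique (path-snoc (rpath-isPath _ _) w~c c∉)

  rpath-prefix : ∀ {r x z} → z ∈ rpath r x → ∃ λ suf → rpath r x ≡ rpath r z ++ suf
  rpath-prefix {r} {x} {z} z∈ with ∈-∃++ z∈
  ... | pre , suf , eq = suf , (begin
    rpath r x                ≡⟨ eq ⟩
    pre ++ z ∷ suf           ≡⟨ ++-assoc pre [ z ] suf ⟨
    (pre ++ [ z ]) ++ suf    ≡⟨ cong (_++ suf) (rpath-unique cut) ⟨
    rpath r z ++ suf         ∎)
    where
    open ≡-Reasoning
    cut : IsPath G r z (pre ++ [ z ])
    cut = path-prefix pre (subst (IsPath G r x) eq (rpath-isPath r x))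

  rpath-trans : ∀ {r x z y} → z ∈ rpath r x → y ∈ rpath r z → y ∈ rpath r x
  rpath-trans z∈ y∈ with rpath-prefix z∈
  ... | _ , eq = subst (_ ∈_) (sym eq) (∈-++⁺ˡ y∈)

  -- Lying on each other's root paths forces equality: the two prefix
  -- decompositions give rpath r z ≡ rpath r x ++ s′ with s′ ++ s ≡ [].
  rpath-antisym : ∀ {r x z} → z ∈ rpath r x → x ∈ rpath r z → z ≡ x
  rpath-antisym {r} {x} {z} z∈ x∈ with rpath-prefix z∈ | rpath-prefix x∈
  ... | s , eq | s′ , eq′ =
    rpath-injective (trans eq′ (trans (cong (rpath r x ++_) s′≡[]) (++-identityʳ _)))
    where
    s′++s≡[] : s′ ++ s ≡ []
    s′++s≡[] = ++-identityʳ-unique (rpath r x) (begin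
      rpath r x                ≡⟨ eq ⟩
      rpath r z ++ s           ≡⟨ cong (_++ s) eq′ ⟩
      (rpath r x ++ s′) ++ s   ≡⟨ ++-assoc (rpath r x) s′ s ⟩
      rpath r x ++ s′ ++ s     ∎)
      where open ≡-Reasoning
    s′≡[] : s′ ≡ []
    s′≡[] = ++-conicalˡ s′ s s′++s≡[]

  branch : Fin m → Fin m → Fin m
  branch r x = second r (rpath r x)

  branch-root : ∀ r → branch r r ≡ r
  branch-root r = cong (second r) (rpath-unique (here , [] ∷ []))

  branch-neighbour : ∀ {r c} → Adj r c → branch r c ≡ c
  branch-neighbour r~c = cong (second _) (rpath-neighbour r~c)

  branch-adjacent : ∀ {r x} → x ≢ r → Adj r (branch r x) × branch r x ∈ rpath r x
  branch-adjacent x≢r = walk-second (rpath-walk _ _) (x≢r ∘ sym)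

  branch-≡-root : ∀ {r x} → branch r x ≡ r → x ≡ r
  branch-≡-root {r} {x} eq with x ≟ᶠ r
  ... | yes x≡r = x≡r
  ... | no x≢r  = ⊥-elim (adj-irrefl (proj₁ (branch-adjacent x≢r)) (sym eq))

  branch-∈ : ∀ {r x c} → branch r x ≡ c → c ≢ r → c ∈ rpath r x
  branch-∈ {r} {x} refl c≢r =
    proj₂ (branch-adjacent λ x≡r → c≢r (trans (cong (branch r) x≡r) (branch-root r)))

  branch-along : ∀ {r x z} → z ∈ rpath r x → z ≢ r → branch r x ≡ branch r z
  branch-along {r} {x} {z} z∈ z≢r with rpath-prefix z∈
  ... | suf , eq = trans (cong (second r) eq)
                         (second-++ r (rpath r z) suf (walk-length-2 (rpath-walk r z) (z≢r ∘ sym)))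

  on-branch : ∀ {r c x} → Adj r c → c ∈ rpath r x → branch r x ≡ c
  on-branch r~c c∈ = trans (branch-along c∈ (adj-irrefl r~c ∘ sym)) (branch-neighbour r~c)

  sides-cover : ∀ {r c x} → Adj r c → c ∉ rpath r x → r ∈ rpath c x
  sides-cover {r} {c} {x} r~c c∉ =
    subst (r ∈_) (sym (rpath-unique (path-cons (adj-sym r~c) (rpath-isPath r x) c∉))) (there (rpath-start r x))

  sides-disjoint : ∀ {r c x} → Adj r c → c ∈ rpath r x → r ∉ rpath c x
  sides-disjoint {r} {c} {x} r~c c∈ r∈ with rpath-prefix c∈
  ... | suf , eq = avoid (subst (r ∈_) (rpath-unique (path-suffix (r ∷ []) path)) r∈)
    where
    path : IsPath G r x (r ∷ c ∷ suf)
    path = subst (IsPath G r x) (trans eq (cong (_++ suf) (rpath-neighbour r~c))) (rpath-isPath r x)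
    avoid : r ∉ c ∷ suf
    avoid (here r≡c)    = adj-irrefl r~c r≡c
    avoid (there r∈suf) = unique-head (proj₂ path) (there r∈suf)

  branch-shift : ∀ {r c x} → Adj r c → branch c x ≢ r → branch r x ≡ c
  branch-shift {r} {c} {x} r~c not-back with c ∈? rpath r x
  ... | yes c∈ = on-branch r~c c∈
  ... | no  c∉ = ⊥-elim (not-back (on-branch (adj-sym r~c) (sides-cover r~c c∉)))

  branch-opposite : ∀ {r c x} → Adj r c → branch r x ≡ c → branch c x ≢ r
  branch-opposite r~c forth back =
    sides-disjoint r~c (branch-∈ forth (adj-irrefl r~c ∘ sym)) (branch-∈ back (adj-irrefl r~c))

  -- A vertex w ≠ r all of whose neighbours lie on its root path is a leaf:
  -- every such neighbour c satisfies rpath r w = rpath r c ++ [ w ], so it is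
  -- the parent of w.
  dead-end-leaf : ∀ {r w} → w ≢ r → (∀ {c} → Adj w c → c ∈ rpath r w) → IsLeaf G w
  dead-end-leaf {r} {w} w≢r stuck =
    ≤-antisym (count-≤1 (adj? w) p is-parent) (count-≥ (adj? w) ([] ∷ []) λ { (here refl) → w~p })
    where
    p : Fin m
    p = second w (reverse (rpath r w))
    w~p : Adj w p
    w~p = proj₁ (walk-second (walk-reverse (rpath-walk r w)) w≢r)
    through-parent : ∀ {c} → Adj w c → rpath r w ≡ rpath r c ++ [ w ]
    through-parent w~c = rpath-extend (adj-sym w~c) λ w∈ → adj-irrefl w~c (sym (rpath-antisym (stuck w~c) w∈))
    is-parent : ∀ {c} → Adj w c → c ≡ p
    is-parent w~c = rpath-injective (proj₁ (∷ʳ-injective _ _ (trans (sym (through-parent w~c)) (through-parent w~p))))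

  -- Every vertex w ≠ r lies on the root path of some leaf: keep stepping away
  -- from r; since paths have at most m vertices this stops within m steps,
  -- and it can only stop at a leaf.
  leaf-below : ∀ r (fuel : ℕ) w → w ≢ r → m < length (rpath r w) + fuel →
               ∃ λ (ℓ : Leaf G) → w ∈ rpath r (proj₁ ℓ)
  leaf-below r zero w _ long = ⊥-elim (<⇒≱ long (subst (_≤ m) (sym (+-identityʳ _)) (rpath-length-≤ r w)))
  leaf-below r (suc fuel) w w≢r long with any? (λ c → adj? w c ×-dec ¬? (c ∈? rpath r w))
  ... | no stuck =
    (w , dead-end-leaf w≢r λ {c} w~c → decidable-stable (c ∈? rpath r w) λ c∉ → stuck (c , w~c , c∉)) ,
    rpath-end r w
  ... | yes (c , w~c , c∉) =
    let ℓ , c∈ = leaf-below r fuel c c≢r longer in ℓ , rpath-trans c∈ w∈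
    where
    extended : rpath r c ≡ rpath r w ++ [ c ]
    extended = rpath-extend w~c c∉
    c≢r : c ≢ r
    c≢r refl = c∉ (rpath-start r w)
    w∈ : w ∈ rpath r c
    w∈ = subst (w ∈_) (sym extended) (∈-++⁺ˡ (rpath-end r w))
    longer : m < length (rpath r c) + fuel
    longer = subst (m <_) (begin
      length (rpath r w) + suc fuel          ≡⟨ +-assoc (length (rpath r w)) 1 fuel ⟨
      length (rpath r w) + 1 + fuel          ≡⟨ cong (_+ fuel) (length-++ (rpath r w)) ⟨
      length (rpath r w ++ [ c ]) + fuel     ≡⟨ cong (λ xs → length xs + fuel) extended ⟨
      length (rpath r c) + fuel              ∎) long
      where open ≡-Reasoning

  via : Fin m → Fin m → Fin m → List (Fin m)
  via r a b = reverse (rpath r a) ++ drop 1 (rpath r b)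

  via-isPath : ∀ r a b → branch r a ≢ branch r b → IsPath G a b (via r a b)
  via-isPath r a b different = path-++ (path-reverse (rpath-isPath r a)) (rpath-isPath r b) disjoint
    where
    -- a common vertex z ≠ r would lie in both branches
    disjoint : Disjoint (reverse (rpath r a)) (drop 1 (rpath r b))
    disjoint {z} (z∈a , z∈b) =
      different (trans (branch-along (Any.reverse⁻ z∈a) z≢r) (sym (branch-along (∈-tail _ z∈b) z≢r)))
      where
      z≢r : z ≢ r
      z≢r = path-leaves-start (rpath-isPath r b) z∈b

  via-⊇ : ∀ r a b {w} → w ∈ rpath r a → w ∈ via r a b
  via-⊇ r a b w∈ = ∈-++⁺ˡ (Any.reverse⁺ w∈)

  through-root : ∀ {r a b} → branch r a ≢ branch r b → OnPath G a b r
  through-root {r} {a} {b} different =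
    via r a b , via-isPath r a b different , via-⊇ r a b (rpath-start r a)

  covering : Leaf G → ∀ {r} (f : Leaf G → Leaf G) →
             (∀ ℓ → branch r (proj₁ ℓ) ≢ branch r (proj₁ (f ℓ))) →
             ∀ w → ∃ λ (ℓ : Leaf G) → OnPath G (proj₁ ℓ) (proj₁ (f ℓ)) w
  covering ℓ₀ {r} f different w with w ≟ᶠ r
  ... | yes refl = ℓ₀ , through-root (different ℓ₀)
  ... | no w≢r   =
    let ℓ , w∈ = leaf-below r (suc m) w w≢r (≤-trans (n<1+n m) (m≤n+m (suc m) _)) in
    ℓ , via r _ _ , via-isPath r _ _ (different ℓ) , via-⊇ r _ _ w∈

-- From any root, step into a branch
-- with more than n leaves; the new heavy branches are strictly smaller than
-- the old one (heavy-step), so the search ends.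

module Centroid {m : ℕ} (G : Graph m) (tree : IsTree G) (n : ℕ) (1≤n : 1 ≤ n)
                (leaf-total : Counting.count (Graphs.isLeaf? G) ≡ n + n) where
  open Graphs G
  open Counting
  open RootedTree G tree

  in-branch? : ∀ r b → Decidable (λ x → branch r x ≡ b)
  in-branch? r b x = branch r x ≟ᶠ b

  leaf-in-branch? : ∀ r b → Decidable (λ x → IsLeaf G x × branch r x ≡ b)
  leaf-in-branch? r b x = isLeaf? x ×-dec in-branch? r b x

  leaves-in : Fin m → Fin m → ℕ
  leaves-in r b = count (leaf-in-branch? r b)

  size : Fin m → Fin m → ℕ
  size r b = count (in-branch? r b)

  Balanced : Fin m → Set
  Balanced r = ∀ b → leaves-in r b ≤ n

  leaves-in-root : ∀ r → leaves-in r r ≤ 1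
  leaves-in-root r = count-≤1 (leaf-in-branch? r r) r (branch-≡-root ∘ proj₂)

  heavy-adjacent : ∀ {r c} → n < leaves-in r c → Adj r c
  heavy-adjacent {r} {c} heavy with count-witness (leaf-in-branch? r c) (≤-trans (s≤s z≤n) heavy)
  ... | x , _ , bx≡c = subst (Adj r) bx≡c (proj₁ (branch-adjacent x≢r))
    where
    c≢r : c ≢ r
    c≢r refl = <⇒≱ heavy (≤-trans (leaves-in-root r) 1≤n)
    x≢r : x ≢ r
    x≢r x≡r = c≢r (trans (sym bx≡c) (trans (cong (branch r) x≡r) (branch-root r)))

  opposite-leaves : ∀ {r c} → Adj r c → leaves-in r c + leaves-in c r ≤ n + n
  opposite-leaves {r} {c} r~c =
    subst (leaves-in r c + leaves-in c r ≤_) leaf-total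
      (count-disjoint (leaf-in-branch? r c) (leaf-in-branch? c r) isLeaf?
         (λ (_ , forth) (_ , back) → branch-opposite r~c forth back) proj₁ proj₁)

  -- Seen from a neighbour c of r, a branch avoiding r and c lies inside the
  -- branch of c seen from r, which also contains c itself.
  smaller-branch : ∀ {r c b} → Adj r c → b ≢ r → b ≢ c → size c b < size r c
  smaller-branch {r} {c} {b} r~c b≢r b≢c =
    count-≥ (in-branch? r c) (c∉ ∷ counted-unique (in-branch? c b)) in-branch
    where
    b-side : List (Fin m)
    b-side = filter (in-branch? c b) (allFin m)
    c∉ : All (c ≢_) b-side
    c∉ = All.¬Any⇒All¬ b-side λ c∈ → b≢c (trans (sym (counted-sound (in-branch? c b) c∈)) (branch-root c))
    in-branch : ∀ {x} → x ∈ c ∷ b-side → branch r x ≡ c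
    in-branch (here refl) = branch-neighbour r~c
    in-branch (there x∈)  =
      branch-shift r~c λ back → b≢r (trans (sym (counted-sound (in-branch? c b) x∈)) back)

  heavy-step : ∀ {r c b} → n < leaves-in r c → n < leaves-in c b → size c b < size r c
  heavy-step {r} {c} {b} heavy heavy′ = smaller-branch r~c b≢r b≢c
    where
    r~c : Adj r c
    r~c = heavy-adjacent heavy
    b≢r : b ≢ r
    b≢r refl = <⇒≱ (+-mono-< heavy heavy′) (opposite-leaves r~c)
    b≢c : b ≢ c
    b≢c refl = <⇒≱ heavy′ (≤-trans (leaves-in-root c) 1≤n)

  search : ∀ (fuel : ℕ) r → (∀ {c} → n < leaves-in r c → size r c < fuel) → ∃ Balanced
  search zero       r bound = r , λ b → ≮⇒≥ (n≮0 ∘ bound)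
  search (suc fuel) r bound with any? (λ c → n <? leaves-in r c)
  ... | no light        = r , λ b → ≮⇒≥ λ heavy → light (b , heavy)
  ... | yes (c , heavy) =
    search fuel c λ heavy′ → <-≤-trans (heavy-step heavy heavy′) (s≤s⁻¹ (bound heavy))

  some-leaf : Leaf G
  some-leaf = count-witness isLeaf? (subst (1 ≤_) (sym leaf-total) (≤-trans 1≤n (m≤m+n n n)))

  -- A balanced root exists: heavy branches have at most m vertices.
  centroid : ∃ Balanced
  centroid = search (suc m) (proj₁ some-leaf) λ _ → s≤s (count-≤-size (in-branch? _ _))

-- Pairing up a duplicate-free list of 2n items so that partners have
-- different keys, provided no key is shared by more than n of the items:
-- sort the list by key and pair the j-th item with the (n+j)-th.  If these
-- had the same key, so would the n+1 items between them (inclusive).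

module Pairing {A : Set} (key : A → ℕ) (n : ℕ) (xs : List A) (xs-unique : Unique xs)
               (xs-length : length xs ≡ n + n)
               (sparse : ∀ {x ys} → Unique ys → (∀ {y} → y ∈ ys → y ∈ xs × key y ≡ key x) →
                         length ys ≤ n)
               where

  by-key : DecTotalOrder _ _ _
  by-key = On.decTotalOrder ≤-decTotalOrder key

  open Sort by-key using (sort; sort-↭; sort-↗)

  sorted : List A
  sorted = sort xs

  sorted-unique : Unique sorted
  sorted-unique = Permutation.Unique-resp-↭ (setoid A) (↭⇒↭ₛ (↭-sym (sort-↭ xs))) xs-unique

  sorted-length : length sorted ≡ n + n
  sorted-length = trans (↭-length (sort-↭ xs)) xs-length

  at : Fin (n + n) → A
  at i = lookup sorted (cast (sym sorted-length) i)

  at-∈ : ∀ i → at i ∈ xs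
  at-∈ i = ∈-resp-↭ (sort-↭ xs) (∈-lookup _)

  at-injective : ∀ {i j} → at i ≡ at j → i ≡ j
  at-injective {i} {j} eq = toℕ-injective (begin
    toℕ i                          ≡⟨ toℕ-cast _ i ⟨
    toℕ (cast (sym sorted-length) i) ≡⟨ cong toℕ (lookup-injective sorted-unique eq) ⟩
    toℕ (cast (sym sorted-length) j) ≡⟨ toℕ-cast _ j ⟩
    toℕ j                          ∎)
    where open ≡-Reasoning

  at-mono : ∀ {i j} → toℕ i ≤ toℕ j → key (at i) ≤ key (at j)
  at-mono {i} {j} i≤j =
    lookup-mono-≤ (DecTotalOrder.totalOrder by-key) (sort-↗ xs)
      (subst₂ _≤_ (sym (toℕ-cast _ i)) (sym (toℕ-cast _ j)) i≤j)

  in-sorted : ∀ {x} → x ∈ xs → x ∈ sorted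
  in-sorted = ∈-resp-↭ (↭-sym (sort-↭ xs))

  position : ∀ {x} → x ∈ xs → Fin (n + n)
  position x∈ = cast sorted-length (index (in-sorted x∈))

  at-position : ∀ {x} (x∈ : x ∈ xs) → at (position x∈) ≡ x
  at-position x∈ =
    trans (cong (lookup sorted) (cast-involutive (sym sorted-length) sorted-length (index (in-sorted x∈))))
          (sym (Any.lookup-index (in-sorted x∈)))

  halves-differ : ∀ (j : Fin n) → key (at (j ↑ˡ n)) ≢ key (at (n ↑ʳ j))
  halves-differ j same =
    <⇒≱ (n<1+n n) (subst (_≤ n) (length-tabulate block) (sparse (Unique.tabulate⁺ block-injective) block-∈))
    where
    between : Fin (suc n) → Fin (n + n)
    between t = fromℕ< (+-mono-<-≤ (toℕ<n j) (s≤s⁻¹ (toℕ<n t)))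
    toℕ-between : ∀ t → toℕ (between t) ≡ toℕ j + toℕ t
    toℕ-between t = toℕ-fromℕ< _
    block : Fin (suc n) → A
    block t = at (between t)
    block-injective : ∀ {t t′} → block t ≡ block t′ → t ≡ t′
    block-injective {t} {t′} eq = toℕ-injective (+-cancelˡ-≡ (toℕ j) _ _
      (trans (sym (toℕ-between t)) (trans (cong toℕ (at-injective eq)) (toℕ-between t′))))
    block-key : ∀ t → key (block t) ≡ key (at (j ↑ˡ n))
    block-key t = ≤-antisym
      (≤-trans (at-mono (subst₂ _≤_ (sym (toℕ-between t)) (sym (toℕ-↑ʳ n j))
                          (≤-trans (+-monoʳ-≤ (toℕ j) (s≤s⁻¹ (toℕ<n t))) (≤-reflexive (+-comm (toℕ j) n)))))
               (≤-reflexive (sym same)))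
      (at-mono (subst₂ _≤_ (sym (toℕ-↑ˡ j n)) (sym (toℕ-between t)) (m≤m+n (toℕ j) (toℕ t))))
    block-∈ : ∀ {y} → y ∈ tabulate block → y ∈ xs × key y ≡ key (at (j ↑ˡ n))
    block-∈ y∈ with ∈-tabulate⁻ {f = block} y∈
    ... | t , refl = at-∈ (between t) , block-key t

  swap-halves : Fin (n + n) → Fin (n + n)
  swap-halves i = Fin.join n n (swap (splitAt n i))

  swap-halves-involutive : ∀ i → swap-halves (swap-halves i) ≡ i
  swap-halves-involutive i = begin
    swap-halves (swap-halves i)               ≡⟨ cong (Fin.join n n ∘ swap) (splitAt-join n n (swap (splitAt n i))) ⟩
    Fin.join n n (swap (swap (splitAt n i)))  ≡⟨ cong (Fin.join n n) (swap-involutive (splitAt n i)) ⟩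
    Fin.join n n (splitAt n i)                ≡⟨ join-splitAt n n i ⟩
    i                                         ∎
    where open ≡-Reasoning

  swap-halves-differ : ∀ i → key (at i) ≢ key (at (swap-halves i))
  swap-halves-differ i with splitAt n i in eq
  ... | inj₁ j = subst (λ k → key (at k) ≢ key (at (n ↑ʳ j))) (splitAt⁻¹-↑ˡ {n} {n} eq) (halves-differ j)
  ... | inj₂ j = subst (λ k → key (at k) ≢ key (at (j ↑ˡ n))) (splitAt⁻¹-↑ʳ {n} {n} eq) (halves-differ j ∘ sym)

  partner : ∀ {x} → x ∈ xs → A
  partner x∈ = at (swap-halves (position x∈))

  partner-∈ : ∀ {x} (x∈ : x ∈ xs) → partner x∈ ∈ xs
  partner-∈ x∈ = at-∈ _

  partner-involutive : ∀ {x} (x∈ : x ∈ xs) (p∈ : partner x∈ ∈ xs) → partner p∈ ≡ x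
  partner-involutive x∈ p∈ = begin
    at (swap-halves (position p∈))                 ≡⟨ cong (at ∘ swap-halves) (at-injective (at-position p∈)) ⟩
    at (swap-halves (swap-halves (position x∈)))   ≡⟨ cong at (swap-halves-involutive _) ⟩
    at (position x∈)                               ≡⟨ at-position x∈ ⟩
    _                                              ∎
    where open ≡-Reasoning

  partner-key : ∀ {x} (x∈ : x ∈ xs) → key x ≢ key (partner x∈)
  partner-key x∈ = subst (λ y → key y ≢ key (partner x∈)) (at-position x∈) (swap-halves-differ (position x∈))

module LeafPairing {m : ℕ} (G : Graph m) (tree : IsTree G) (n : ℕ) (1≤n : 1 ≤ n)
                   (leaf-total : Counting.count (Graphs.isLeaf? G) ≡ n + n) where
  open Graphs G using (isLeaf?; leaf-∈; Leaf-≡)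
  open Counting
  open RootedTree G tree
  open Centroid G tree n 1≤n leaf-total

  pairing : ∀ {r} → Balanced r →
            Σ (Leaf G ⤖ Leaf G) λ α → ∀ ℓ → branch r (proj₁ ℓ) ≢ branch r (proj₁ (Bijection.to α ℓ))
  pairing {r} balanced =
    ↔⇒⤖ (mk↔ₛ′ α α α-involutive α-involutive) , λ ℓ → partner-key (leaf-∈ ℓ) ∘ cong toℕ
    where
    sparse : ∀ {x ys} → Unique ys →
             (∀ {y} → y ∈ ys → y ∈ leaves G × toℕ (branch r y) ≡ toℕ (branch r x)) → length ys ≤ n
    sparse {x} u all =
      ≤-trans (count-≥ (leaf-in-branch? r (branch r x)) u
                 λ y∈ → counted-sound isLeaf? (proj₁ (all y∈)) , toℕ-injective (proj₂ (all y∈)))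
              (balanced (branch r x))
    open Pairing (toℕ ∘ branch r) n (leaves G) (counted-unique isLeaf?) leaf-total sparse
    α : Leaf G → Leaf G
    α ℓ = partner (leaf-∈ ℓ) , counted-sound isLeaf? (partner-∈ (leaf-∈ ℓ))
    α-involutive : ∀ ℓ → α (α ℓ) ≡ ℓ
    α-involutive ℓ = Leaf-≡ (partner-involutive (leaf-∈ ℓ) (leaf-∈ (α ℓ)))

  balanced-pairing : Σ (Fin m) λ r → Σ (Leaf G ⤖ Leaf G) λ α →
                       ∀ ℓ → branch r (proj₁ ℓ) ≢ branch r (proj₁ (Bijection.to α ℓ))
  balanced-pairing = proj₁ centroid , pairing (proj₂ centroid)

theorem1 : (m n : ℕ) (T' : Graph m) → IsTree T' → 1 ≤ n →
    length (leaves T') ≡ 2 * n →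
    Σ (Fin m) λ v → Σ (Leaf T' ⤖ Leaf T') λ α →
      (∀ w → ∃ λ (ℓ : Leaf T') →
        OnPath T' (proj₁ ℓ) (proj₁ (Bijection.to α ℓ)) w)
      × (∀ (ℓ : Leaf T') → OnPath T' (proj₁ ℓ) (proj₁ (Bijection.to α ℓ)) v)
theorem1 m n T' tree 1≤n leaf-count =
  let r , α , different = balanced-pairing in
  r , α , covering some-leaf (Bijection.to α) different , through-root ∘ different
  where
  -- 2 * n unfolds to n + (n + 0)
  leaf-total : length (leaves T') ≡ n + n
  leaf-total = trans leaf-count (cong (n +_) (+-identityʳ n))
  open RootedTree T' tree using (covering; through-root)
  open Centroid T' tree n 1≤n leaf-total using (some-leaf)
  open LeafPairing T' tree n 1≤n leaf-total using (balanced-pairing)
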